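{- Let $G$ be a finite abelian group of order $n$ and $k$ a positive integer. Let $S\subseteq (G\ast F_k)^{\mathrm{ab}}$ be a set of elements each of which is linear in at least one free variable, and let $U\subseteq G$. Then the number of projections $\pi\colon (G\ast F_k)^{\mathrm{ab}}\to G$ for which $\pi(S)\cap U\neq\emptyset$ is at most $|S||U|n^{k-1}$.
   Context: $F_k$ is the free abelian group on free variables $v_1,\dots,v_k$ and $(G\ast F_k)^{\mathrm{ab}}$ is the abelianization of the free product (isomorphic to $G\times F_k$); each element is uniquely $z_1v_1+\dots+z_kv_k+g$ with $z_j\in\mathbb{Z}$, $g\in G$. An element is linear in $v_i$ if the coefficient $z_i$ of $v_i$ is $\pm1$. A projection is a homomorphism $\pi\colon(G\ast F_k)^{\mathrm{ab}}\to G$ with $\pi(g)=g$ for all $g\in G$. -}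

module Defs where

open import Level using (Level; _⊔_; Lift) renaming (suc to lsuc)
open import Function using (_∘_)
open import Algebra.Bundles using (AbelianGroup)
open import Data.Nat using (ℕ; zero; suc; _+_)
open import Data.Integer using (ℤ; +_; -[1+_])
open import Data.Fin using (Fin; zero; suc)
open import Data.Vec using (Vec; []; _∷_; lookup)
open import Data.Bool using (Bool; if_then_else_)
open import Data.List using (List)
open import Data.List.Relation.Unary.Any using (Any; any?)
open import Data.List.Relation.Unary.All using (All)
open import Data.List.Relation.Unary.AllPairs using (AllPairs)
open import Data.Product using (Σ; ∃; _×_; _,_)
open import Data.Sum using (_⊎_)
open import Relation.Nullary using (¬_; Dec; does)
open import Relation.Binary using (Decidable)
open import Relation.Binary.PropositionalEquality using (_≡_)

record FiniteAbelianGroup (c ℓ : Level) (n : ℕ) : Set (lsuc (c ⊔ ℓ)) where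
  field
    abGroup : AbelianGroup c ℓ
  open AbelianGroup abGroup public
  field
    _≟_       : Decidable _≈_
    enum      : Fin n → Carrier
    enum-surj : ∀ x → ∃ λ i → enum i ≈ x
    enum-inj  : ∀ i j → enum i ≈ enum j → i ≡ j

sumFin : (m : ℕ) → (Fin m → ℕ) → ℕ
sumFin zero    f = 0
sumFin (suc m) f = f zero + sumFin m (f ∘ suc)

extend : ∀ {a} {A : Set a} {k : ℕ} → A → (Fin k → A) → Fin (suc k) → A
extend x t zero    = x
extend x t (suc j) = t j

countTuples : (n k : ℕ) → ((Fin k → Fin n) → Bool) → ℕ
countTuples n zero    P = if P (λ ()) then 1 else 0
countTuples n (suc k) P = sumFin n (λ i → countTuples n k (λ t → P (extend i t)))

module _ {c ℓ n} (G : FiniteAbelianGroup c ℓ n) where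
  open FiniteAbelianGroup G

  _·ℕ_ : ℕ → Carrier → Carrier
  zero  ·ℕ x = ε
  suc m ·ℕ x = x ∙ (m ·ℕ x)

  _·ℤ_ : ℤ → Carrier → Carrier
  (+ m)    ·ℤ x = m ·ℕ x
  -[1+ m ] ·ℤ x = (suc m ·ℕ x) ⁻¹

  -- (G * F_k)^ab ≅ ℤ^k × G : the element z₁v₁+…+z_kv_k+g is (z , g)
  Elem : ℕ → Set c
  Elem k = Vec ℤ k × Carrier

  _≈E_ : ∀ {k} → Elem k → Elem k → Set ℓ
  (z , g) ≈E (z' , g') = Lift ℓ (z ≡ z') × (g ≈ g')

  linComb : ∀ {k} → (Fin k → Carrier) → Vec ℤ k → Carrier
  linComb a []       = ε
  linComb a (z ∷ zs) = (z ·ℤ a zero) ∙ linComb (a ∘ suc) zs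

  -- The projection π_a : (G * F_k)^ab → G with π_a(v_i) = a_i and π_a(g) = g.
  -- Every projection is π_a for exactly one a ∈ G^k.
  project : ∀ {k} → (Fin k → Carrier) → Elem k → Carrier
  project a (z , g) = linComb a z ∙ g

  LinearIn : ∀ {k} → Fin k → Elem k → Set
  LinearIn i (z , g) = (lookup z i ≡ + 1) ⊎ (lookup z i ≡ -[1+ 0 ])

  LinearInSome : ∀ {k} → Elem k → Set
  LinearInSome {k} s = Σ (Fin k) λ i → LinearIn i s

  Hits : ∀ {k} → List (Elem k) → List Carrier → (Fin k → Carrier) → Set (c ⊔ ℓ)
  Hits S U a = Any (λ s → Any (λ u → project a s ≈ u) U) S

  hits? : ∀ {k} (S : List (Elem k)) (U : List Carrier) (a : Fin k → Carrier) → Dec (Hits S U a)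
  hits? S U a = any? (λ s → any? (λ u → project a s ≟ u) U) S

  numHittingProjections : ∀ {k} → List (Elem k) → List Carrier → ℕ
  numHittingProjections {k} S U = countTuples n k (λ t → does (hits? S U (enum ∘ t)))

-- A projection is π_a for a unique a ∈ Gᵏ. By the union bound over the pairs
-- (s , u) ∈ S × U it suffices that, for s linear in v_i, at most nᵏ⁻¹ tuples a
-- satisfy π_a(s) = u. Indeed, once the coordinates a_j (j ≠ i) are fixed, the
-- equation π_a(s) = u reads ±a_i = u − (terms not involving a_i), so it
-- determines a_i.
module Submission where

open import Defs
open import Data.Nat using (ℕ; zero; suc; _+_; _*_; _^_; _∸_; _≤_; z≤n)
open import Data.List using (List; []; _∷_; length)
open import Data.List.Relation.Unary.All using (All)
open import Data.List.Relation.Unary.AllPairs using (AllPairs)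
open import Relation.Nullary using (¬_; does; yes)

open import Data.Nat.Properties
  using (≤-refl; ≤-trans; ≤-reflexive; m≤m+n; +-mono-≤; +-monoʳ-≤;
         *-assoc; *-identityˡ; *-identityʳ; *-zeroʳ; +-commutativeSemigroup; module ≤-Reasoning)
open import Data.Bool using (Bool; true; false; T; _∨_; if_then_else_)
open import Data.Bool.Properties using (¬-not; T-≡)
open import Data.Fin using (Fin; zero; suc)
open import Data.Fin.Properties using (0≢1+n; suc-injective)
open import Data.Integer using (ℤ; -[1+_]) renaming (+_ to ℤ+_)
open import Data.List.Relation.Unary.Any using (any?)
import Data.List.Relation.Unary.All as All
open import Data.Vec using ([]; _∷_; lookup)
open import Data.Product using (_,_)
open import Data.Sum using (_⊎_; inj₁; inj₂)
open import Data.Empty using (⊥-elim)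
open import Function using (_∘_)
open import Function.Bundles using (Equivalence)
open import Relation.Unary using (Pred; Decidable)
open import Relation.Binary.PropositionalEquality
  using (_≡_; _≢_; refl; sym; trans; cong; cong₂)
import Algebra.Properties.Group as GroupProperties
import Algebra.Properties.CommutativeSemigroup as CommutativeSemigroupProperties
import Relation.Binary.Reasoning.Setoid as SetoidReasoning

open CommutativeSemigroupProperties +-commutativeSemigroup using (interchange)

indicator : Bool → ℕ
indicator b = if b then 1 else 0

indicator-∨ : ∀ a b → indicator (a ∨ b) ≤ indicator a + indicator b
indicator-∨ false b = ≤-refl
indicator-∨ true  b = m≤m+n 1 (indicator b)

sumFin-cong : ∀ m {f g : Fin m → ℕ} → (∀ i → f i ≡ g i) → sumFin m f ≡ sumFin m g
sumFin-cong zero    f≡g = refl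
sumFin-cong (suc m) f≡g = cong₂ _+_ (f≡g zero) (sumFin-cong m (f≡g ∘ suc))

sumFin-mono : ∀ m {f g : Fin m → ℕ} → (∀ i → f i ≤ g i) → sumFin m f ≤ sumFin m g
sumFin-mono zero    f≤g = z≤n
sumFin-mono (suc m) f≤g = +-mono-≤ (f≤g zero) (sumFin-mono m (f≤g ∘ suc))

sumFin-const : ∀ m c → sumFin m (λ _ → c) ≡ m * c
sumFin-const zero    c = refl
sumFin-const (suc m) c = cong (c +_) (sumFin-const m c)

sumFin-+ : ∀ m (f g : Fin m → ℕ) → sumFin m (λ i → f i + g i) ≡ sumFin m f + sumFin m g
sumFin-+ zero    f g = refl
sumFin-+ (suc m) f g =
  trans (cong (f zero + g zero +_) (sumFin-+ m (f ∘ suc) (g ∘ suc))) (interchange (f zero) (g zero) _ _)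

sumFin-comm : ∀ m p (f : Fin m → Fin p → ℕ) →
  sumFin m (λ x → sumFin p (f x)) ≡ sumFin p (λ y → sumFin m (λ x → f x y))
sumFin-comm zero    p f = sym (trans (sumFin-const p 0) (*-zeroʳ p))
sumFin-comm (suc m) p f =
  trans (cong (sumFin p (f zero) +_) (sumFin-comm m p (f ∘ suc))) (sym (sumFin-+ p (f zero) _))

sumFin-indicator-false : ∀ m (f : Fin m → Bool) → (∀ i → f i ≡ false) → sumFin m (indicator ∘ f) ≡ 0
sumFin-indicator-false zero    f all-false = refl
sumFin-indicator-false (suc m) f all-false
  rewrite all-false zero = sumFin-indicator-false m (f ∘ suc) (all-false ∘ suc)

sumFin-indicator-≤1 : ∀ m (f : Fin m → Bool) → (∀ i j → T (f i) → T (f j) → i ≡ j) →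
  sumFin m (indicator ∘ f) ≤ 1
sumFin-indicator-≤1 zero    f unique = z≤n
sumFin-indicator-≤1 (suc m) f unique with f zero in f0≡true
... | false = sumFin-indicator-≤1 m (f ∘ suc) (λ i j fi fj → suc-injective (unique (suc i) (suc j) fi fj))
... | true  = ≤-reflexive (cong suc (sumFin-indicator-false m (f ∘ suc) others-false))
  where
  others-false : ∀ i → f (suc i) ≡ false
  others-false i = ¬-not λ fi≡true →
    0≢1+n (unique zero (suc i) (Equivalence.from T-≡ f0≡true) (Equivalence.from T-≡ fi≡true))

sumTuples : (n k : ℕ) → ((Fin k → Fin n) → ℕ) → ℕ
sumTuples n zero    f = f (λ ())
sumTuples n (suc k) f = sumFin n (λ x → sumTuples n k (f ∘ extend x))

countTuples≡sumTuples : ∀ n k (P : (Fin k → Fin n) → Bool) →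
  countTuples n k P ≡ sumTuples n k (indicator ∘ P)
countTuples≡sumTuples n zero    P = refl
countTuples≡sumTuples n (suc k) P = sumFin-cong n (λ x → countTuples≡sumTuples n k (P ∘ extend x))

sumTuples-mono : ∀ n k {f g : (Fin k → Fin n) → ℕ} → (∀ t → f t ≤ g t) → sumTuples n k f ≤ sumTuples n k g
sumTuples-mono n zero    f≤g = f≤g _
sumTuples-mono n (suc k) f≤g = sumFin-mono n (λ x → sumTuples-mono n k (f≤g ∘ extend x))

sumTuples-const : ∀ n k c → sumTuples n k (λ _ → c) ≡ n ^ k * c
sumTuples-const n zero    c = sym (*-identityˡ c)
sumTuples-const n (suc k) c = trans (sumFin-cong n (λ _ → sumTuples-const n k c))
                                    (trans (sumFin-const n (n ^ k * c)) (sym (*-assoc n (n ^ k) c)))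

sumTuples-+ : ∀ n k (f g : (Fin k → Fin n) → ℕ) →
  sumTuples n k (λ t → f t + g t) ≡ sumTuples n k f + sumTuples n k g
sumTuples-+ n zero    f g = refl
sumTuples-+ n (suc k) f g =
  trans (sumFin-cong n (λ x → sumTuples-+ n k (f ∘ extend x) (g ∘ extend x))) (sumFin-+ n _ _)

sumFin-sumTuples-comm : ∀ n k m (f : Fin m → (Fin k → Fin n) → ℕ) →
  sumFin m (λ x → sumTuples n k (f x)) ≡ sumTuples n k (λ t → sumFin m (λ x → f x t))
sumFin-sumTuples-comm n zero    m f = refl
sumFin-sumTuples-comm n (suc k) m f =
  trans (sumFin-comm m n (λ x y → sumTuples n k (f x ∘ extend y)))
        (sumFin-cong n (λ y → sumFin-sumTuples-comm n k m (λ x → f x ∘ extend y)))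

DeterminedAt : ∀ {n k} → Fin k → ((Fin k → Fin n) → Bool) → Set
DeterminedAt i P = ∀ t t' → (∀ j → j ≢ i → t j ≡ t' j) → T (P t) → T (P t') → t i ≡ t' i

sumTuples-determinedAt : ∀ n k (i : Fin k) (P : (Fin k → Fin n) → Bool) → DeterminedAt i P →
  sumTuples n k (indicator ∘ P) ≤ n ^ (k ∸ 1)
sumTuples-determinedAt n (suc k) zero P determined = begin
  sumTuples n (suc k) (indicator ∘ P)
    ≡⟨ sumFin-sumTuples-comm n k n (λ x t → indicator (P (extend x t))) ⟩
  sumTuples n k (λ t → sumFin n (λ x → indicator (P (extend x t))))
    ≤⟨ sumTuples-mono n k (λ t → sumFin-indicator-≤1 n (λ x → P (extend x t))
                                    (λ x y → determined (extend x t) (extend y t) (agreeOff0 t x y))) ⟩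
  sumTuples n k (λ _ → 1)
    ≡⟨ sumTuples-const n k 1 ⟩
  n ^ k * 1
    ≡⟨ *-identityʳ (n ^ k) ⟩
  n ^ k ∎
  where
  open ≤-Reasoning
  agreeOff0 : ∀ t x y j → j ≢ zero → extend x t j ≡ extend y t j
  agreeOff0 t x y zero    j≢0 = ⊥-elim (j≢0 refl)
  agreeOff0 t x y (suc j) j≢0 = refl
sumTuples-determinedAt n (suc (suc k)) (suc i) P determined =
  ≤-trans (sumFin-mono n (λ x → sumTuples-determinedAt n (suc k) i (P ∘ extend x) (slice x)))
          (≤-reflexive (sumFin-const n (n ^ k)))
  where
  slice : ∀ x → DeterminedAt i (P ∘ extend x)
  slice x t t' agree = determined (extend x t) (extend x t') λ
    { zero    _   → refl
    ; (suc j) j≢i → agree j (j≢i ∘ cong suc) }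

sumList : ∀ {a} {A : Set a} → List A → (A → ℕ) → ℕ
sumList []       f = 0
sumList (x ∷ xs) f = f x + sumList xs f

sumList-mono : ∀ {a} {A : Set a} {xs : List A} {f g : A → ℕ} →
  All (λ x → f x ≤ g x) xs → sumList xs f ≤ sumList xs g
sumList-mono All.[]              = z≤n
sumList-mono (fx≤gx All.∷ rest) = +-mono-≤ fx≤gx (sumList-mono rest)

sumList-const : ∀ {a} {A : Set a} (xs : List A) c → sumList xs (λ _ → c) ≡ length xs * c
sumList-const []       c = refl
sumList-const (x ∷ xs) c = cong (c +_) (sumList-const xs c)

union-bound : ∀ {a p} {A : Set a} {P : Pred A p} (P? : Decidable P) (xs : List A) →
  indicator (does (any? P? xs)) ≤ sumList xs (indicator ∘ does ∘ P?)
union-bound P? []       = z≤n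
union-bound P? (x ∷ xs) = ≤-trans (indicator-∨ (does (P? x)) _) (+-monoʳ-≤ _ (union-bound P? xs))

sumTuples-sumList : ∀ {a} {A : Set a} n k (xs : List A) (f : A → (Fin k → Fin n) → ℕ) →
  sumTuples n k (λ t → sumList xs (λ x → f x t)) ≡ sumList xs (λ x → sumTuples n k (f x))
sumTuples-sumList n k []       f = trans (sumTuples-const n k 0) (*-zeroʳ (n ^ k))
sumTuples-sumList n k (x ∷ xs) f =
  trans (sumTuples-+ n k (f x) _) (cong (sumTuples n k (f x) +_) (sumTuples-sumList n k xs f))

module _ {c ℓ n} (G : FiniteAbelianGroup c ℓ n) where
  open FiniteAbelianGroup G
    renaming (refl to ≈-refl; sym to ≈-sym; trans to ≈-trans; reflexive to ≈-reflexive)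
  open GroupProperties group using (∙-cancelˡ; ∙-cancelʳ; ⁻¹-injective)
  open CommutativeSemigroupProperties commutativeSemigroup using (xy∙z≈zy∙x)

  private
    infixr 8 _·_
    _·_ : ℤ → Carrier → Carrier
    w · x = _·ℤ_ G w x

  ·ℕ-cong : ∀ m {x y} → x ≈ y → _·ℕ_ G m x ≈ _·ℕ_ G m y
  ·ℕ-cong zero    x≈y = ≈-refl
  ·ℕ-cong (suc m) x≈y = ∙-cong x≈y (·ℕ-cong m x≈y)

  ·ℤ-cong : ∀ w {x y} → x ≈ y → w · x ≈ w · y
  ·ℤ-cong (ℤ+ m)   x≈y = ·ℕ-cong m x≈y
  ·ℤ-cong -[1+ m ] x≈y = ⁻¹-cong (·ℕ-cong (suc m) x≈y)

  ·ℤ-unit-injective : ∀ {w x y} → w ≡ ℤ+ 1 ⊎ w ≡ -[1+ 0 ] → w · x ≈ w · y → x ≈ y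
  ·ℤ-unit-injective (inj₁ refl) x∙ε≈y∙ε = ∙-cancelʳ ε _ _ x∙ε≈y∙ε
  ·ℤ-unit-injective (inj₂ refl) eq      = ∙-cancelʳ ε _ _ (⁻¹-injective eq)

  linComb-cong : ∀ {k} {a a' : Fin k → Carrier} → (∀ j → a j ≈ a' j) → ∀ z → linComb G a z ≈ linComb G a' z
  linComb-cong a≈a' []       = ≈-refl
  linComb-cong a≈a' (w ∷ zs) = ∙-cong (·ℤ-cong w (a≈a' zero)) (linComb-cong (a≈a' ∘ suc) zs)

  -- Both sides equal Σ_{j ≠ i} z_j a_j + z_i a_i + z_i a'_i.
  linComb-exchange : ∀ {k} (a a' : Fin k → Carrier) (i : Fin k) → (∀ j → j ≢ i → a j ≈ a' j) → ∀ z →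
    linComb G a z ∙ lookup z i · a' i ≈ linComb G a' z ∙ lookup z i · a i
  linComb-exchange a a' zero agree (w ∷ zs) =
    ≈-trans (xy∙z≈zy∙x _ _ _) (∙-congʳ (∙-congˡ (linComb-cong (λ j → agree (suc j) (0≢1+n ∘ sym)) zs)))
  linComb-exchange a a' (suc i) agree (w ∷ zs) = begin
    (w · a zero ∙ linComb G (a ∘ suc) zs) ∙ lookup zs i · a' (suc i)
      ≈⟨ assoc _ _ _ ⟩
    w · a zero ∙ (linComb G (a ∘ suc) zs ∙ lookup zs i · a' (suc i))
      ≈⟨ ∙-cong (·ℤ-cong w (agree zero 0≢1+n))
                (linComb-exchange (a ∘ suc) (a' ∘ suc) i (λ j j≢i → agree (suc j) (j≢i ∘ suc-injective)) zs) ⟩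
    w · a' zero ∙ (linComb G (a' ∘ suc) zs ∙ lookup zs i · a (suc i))
      ≈⟨ assoc _ _ _ ⟨
    (w · a' zero ∙ linComb G (a' ∘ suc) zs) ∙ lookup zs i · a (suc i) ∎
    where open SetoidReasoning setoid

  project-determinesAt : ∀ {k} (s : Elem G k) (i : Fin k) → LinearIn G i s →
    (a a' : Fin k → Carrier) → (∀ j → j ≢ i → a j ≈ a' j) → project G a s ≈ project G a' s → a i ≈ a' i
  project-determinesAt (z , g) i linear a a' agree πs≈π's =
    ≈-sym (·ℤ-unit-injective linear (∙-cancelˡ (linComb G a' z) _ _ (begin
      linComb G a' z ∙ lookup z i · a' i  ≈⟨ ∙-congʳ (∙-cancelʳ g _ _ πs≈π's) ⟨
      linComb G a z ∙ lookup z i · a' i   ≈⟨ linComb-exchange a a' i agree z ⟩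
      linComb G a' z ∙ lookup z i · a i   ∎)))
    where open SetoidReasoning setoid

  projectsTo : ∀ {k} → Elem G k → Carrier → (Fin k → Fin n) → Bool
  projectsTo s u t = does (project G (enum ∘ t) s ≟ u)

  projectsTo-determinedAt : ∀ {k} (s : Elem G k) (i : Fin k) → LinearIn G i s → ∀ u →
    DeterminedAt i (projectsTo s u)
  projectsTo-determinedAt s i linear u t t' agree hit hit' =
    enum-inj (t i) (t' i) (project-determinesAt s i linear (enum ∘ t) (enum ∘ t')
      (λ j j≢i → ≈-reflexive (cong enum (agree j j≢i))) (≈-trans (witness t hit) (≈-sym (witness t' hit'))))
    where
    witness : ∀ t → T (projectsTo s u t) → project G (enum ∘ t) s ≈ u
    witness t hit with project G (enum ∘ t) s ≟ u
    ... | yes π≈u = π≈u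

  sumTuples-projectsTo : ∀ {k} (s : Elem G k) → LinearInSome G s → (U : List Carrier) →
    sumTuples n k (λ t → sumList U (λ u → indicator (projectsTo s u t))) ≤ length U * n ^ (k ∸ 1)
  sumTuples-projectsTo {k} s (i , linear) U = begin
    sumTuples n k (λ t → sumList U (λ u → indicator (projectsTo s u t)))
      ≡⟨ sumTuples-sumList n k U (λ u → indicator ∘ projectsTo s u) ⟩
    sumList U (λ u → sumTuples n k (indicator ∘ projectsTo s u))
      ≤⟨ sumList-mono (All.universal (λ u → sumTuples-determinedAt n k i _ (projectsTo-determinedAt s i linear u)) U) ⟩
    sumList U (λ _ → n ^ (k ∸ 1))
      ≡⟨ sumList-const U (n ^ (k ∸ 1)) ⟩
    length U * n ^ (k ∸ 1) ∎
    where open ≤-Reasoning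

  hits-union-bound : ∀ {k} (S : List (Elem G k)) (U : List Carrier) (t : Fin k → Fin n) →
    indicator (does (hits? G S U (enum ∘ t))) ≤ sumList S (λ s → sumList U (λ u → indicator (projectsTo s u t)))
  hits-union-bound S U t =
    ≤-trans (union-bound _ S) (sumList-mono (All.universal (λ s → union-bound _ U) S))

-- The bound holds without 1 ≤ k and without S and U being duplicate-free.
lemma3p9 : ∀ {c ℓ n} (G : FiniteAbelianGroup c ℓ n) (k : ℕ) → 1 ≤ k →
    (S : List (Elem G k)) → AllPairs (λ s t → ¬ _≈E_ G s t) S → All (LinearInSome G) S →
    (U : List (FiniteAbelianGroup.Carrier G)) →
    AllPairs (λ u v → ¬ FiniteAbelianGroup._≈_ G u v) U →
    numHittingProjections G S U ≤ length S * length U * n ^ (k ∸ 1)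
lemma3p9 {n = n} G k _ S _ linear U _ = begin
  numHittingProjections G S U
    ≡⟨ countTuples≡sumTuples n k _ ⟩
  sumTuples n k (λ t → indicator (does (hits? G S U (enum ∘ t))))
    ≤⟨ sumTuples-mono n k (hits-union-bound G S U) ⟩
  sumTuples n k (λ t → sumList S (λ s → sumList U (λ u → indicator (projectsTo G s u t))))
    ≡⟨ sumTuples-sumList n k S _ ⟩
  sumList S (λ s → sumTuples n k (λ t → sumList U (λ u → indicator (projectsTo G s u t))))
    ≤⟨ sumList-mono (All.map (λ {s} linear-s → sumTuples-projectsTo G s linear-s U) linear) ⟩
  sumList S (λ _ → length U * n ^ (k ∸ 1))
    ≡⟨ sumList-const S _ ⟩
  length S * (length U * n ^ (k ∸ 1))
    ≡⟨ *-assoc (length S) (length U) _ ⟨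
  length S * length U * n ^ (k ∸ 1) ∎
  where
  open ≤-Reasoning
  open FiniteAbelianGroup G using (enum)
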